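{- If $n\geq 3$ and $C_n$ is the cycle on $n$ vertices, then $B(C_n) = 2$ if $n\leq 5$ and $B(C_n) = 3$ if $n>5$.
   Context: Bodyguards and Presidents is a two-player game on a finite simple graph $G$. One player controls a set of tokens called bodyguards, the other a single token called the president. First all bodyguards are placed on vertices (several may share a vertex), then the president is placed. The players then alternate turns, bodyguards first; on a player's turn, each token they control either moves to an adjacent vertex or stays put. The president is surrounded if every vertex of the open neighbourhood of the president's vertex is occupied by a bodyguard. The bodyguards win if there is a finite time after which, at the end of every bodyguard turn, the president is surrounded; otherwise the president wins. The bodyguard number $B(G)$ is the minimum number of bodyguards that guarantees a win for the bodyguards on $G$. -}

module Defs where

open import Data.Nat using (ℕ; zero; suc; _≤_; _<_)
open import Data.Fin using (Fin; toℕ)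
open import Data.Vec using (Vec; []; _∷_; head)
open import Data.Product using (_×_; _,_; proj₁; proj₂; ∃; Σ)
open import Data.Sum using (_⊎_)
open import Relation.Binary.PropositionalEquality using (_≡_)
open import Relation.Nullary using (¬_)

record Graph : Set₁ where
  field
    n     : ℕ
    Adj   : Fin n → Fin n → Set
    sym   : ∀ {u v} → Adj u v → Adj v u
    irrefl : ∀ {u} → ¬ Adj u u

-- The cycle C_n on vertices 0,…,n-1: i ~ j iff they differ by one
-- (mod n).  For n ≥ 3 this is the simple cycle graph.
CycleAdj : (n : ℕ) → Fin n → Fin n → Set
CycleAdj n i j =
  (toℕ j ≡ suc (toℕ i)) ⊎ (toℕ i ≡ suc (toℕ j))
  ⊎ ((toℕ i ≡ 0 × suc (toℕ j) ≡ n) ⊎ (toℕ j ≡ 0 × suc (toℕ i) ≡ n))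

private
  open import Data.Sum using (inj₁; inj₂)
  n≢1+n : ∀ m → ¬ m ≡ suc m
  n≢1+n zero ()
  n≢1+n (suc m) e = n≢1+n m (Relation.Binary.PropositionalEquality.cong Data.Nat.pred e)
  open import Relation.Binary.PropositionalEquality using (sym; trans)

  cyc-sym : ∀ {n} {u v : Fin n} → CycleAdj n u v → CycleAdj n v u
  cyc-sym (inj₁ p) = inj₂ (inj₁ p)
  cyc-sym (inj₂ (inj₁ p)) = inj₁ p
  cyc-sym (inj₂ (inj₂ (inj₁ p))) = inj₂ (inj₂ (inj₂ p))
  cyc-sym (inj₂ (inj₂ (inj₂ p))) = inj₂ (inj₂ (inj₁ p))

  cyc-irr : ∀ {n} (m : ℕ) → 3 ≤ n → {u : Fin n} → ¬ CycleAdj n u u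
  cyc-irr _ _ (inj₁ p) = n≢1+n _ p
  cyc-irr _ _ (inj₂ (inj₁ p)) = n≢1+n _ p
  cyc-irr _ h {u} (inj₂ (inj₂ (inj₁ (p , q)))) = bad h (trans (sym q) (Relation.Binary.PropositionalEquality.cong suc p))
    where
    bad : ∀ {n} → 3 ≤ n → ¬ n ≡ 1
    bad (Data.Nat.s≤s ()) Relation.Binary.PropositionalEquality.refl
  cyc-irr _ h {u} (inj₂ (inj₂ (inj₂ (p , q)))) = bad h (trans (sym q) (Relation.Binary.PropositionalEquality.cong suc p))
    where
    bad : ∀ {n} → 3 ≤ n → ¬ n ≡ 1
    bad (Data.Nat.s≤s ()) Relation.Binary.PropositionalEquality.refl

Cycle : (n : ℕ) → 3 ≤ n → Graph
Cycle n h = record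
  { n = n ; Adj = CycleAdj n ; sym = cyc-sym ; irrefl = cyc-irr 0 h }

module Game (G : Graph) (k : ℕ) where
  open Graph G

  -- positions of the k bodyguards (several may share a vertex)
  Config : Set
  Config = Fin k → Fin n

  MoveOK : Fin n → Fin n → Set
  MoveOK u v = (u ≡ v) ⊎ Adj u v

  BGStep : Config → Config → Set
  BGStep b b′ = ∀ i → MoveOK (b i) (b′ i)

  -- game state after a full round: bodyguard positions and president vertex
  State : Set
  State = Config × Fin n

  -- history of the play: a vector of states, most recent first
  History : ℕ → Set
  History t = Vec State (suc t)

  record BGStrategy : Set where
    field
      place : Config
      move  : ∀ {t} → History t → Config
      legal : ∀ {t} (h : History t) → BGStep (proj₁ (head h)) (move h)

  record PStrategy : Set where
    field
      place : Config → Fin n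
      move  : ∀ {t} → History t → Config → Fin n
      legal : ∀ {t} (h : History t) (b : Config) →
              MoveOK (proj₂ (head h)) (move h b)

  play : BGStrategy → PStrategy → (t : ℕ) → History t
  play σ τ zero = (BGStrategy.place σ , PStrategy.place τ (BGStrategy.place σ)) ∷ []
  play σ τ (suc t) =
    let h = play σ τ t
        b = BGStrategy.move σ h
    in (b , PStrategy.move τ h b) ∷ h

  Surrounded : Config → Fin n → Set
  Surrounded b p = ∀ v → Adj p v → ∃ λ i → b i ≡ v

  -- at the end of the bodyguard turn of round t+1, bodyguards are at
  -- position b_{t+1} while the president is still at p_t
  BGWins : Set
  BGWins = Σ BGStrategy λ σ → ∀ (τ : PStrategy) → ∃ λ T → ∀ t → T ≤ t →
    Surrounded (proj₁ (head (play σ τ (suc t)))) (proj₂ (head (play σ τ t)))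

BodyguardsWin : Graph → ℕ → Set
BodyguardsWin G k = Game.BGWins G k

BodyguardNumberIs : Graph → ℕ → Set
BodyguardNumberIs G m = BodyguardsWin G m × (∀ k → k < m → ¬ BodyguardsWin G k)

-- Moves commute with the rotations of C_n, so everything is done in coordinates relative to
-- the president: a guard is a residue mod n, and the president is surrounded exactly when
-- some guard is at +1 and some guard is at -1.
--
-- One guard cannot occupy both neighbours.  On C_n with n ≥ 6 the president
-- beats two guards by keeping the invariant that no guard able to reach +1 in one step is
-- paired with another guard able to reach -1: such a position cannot be surrounded by the
-- guards' next move, and after that move one of his three options restores the invariant.
--
-- The guards play greedily for a potential that they can always decrease by
-- one, and that stays 0 once the president is surrounded (a surround can be maintained).
-- For n ≤ 5 the potential is 0, 1 or 2 according as the president is surrounded, trapped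
-- (surrounded after whatever step he takes) or neither; an exhaustive check shows that two
-- guards can always reach a surround or a trap in one move.  For n ≥ 6 one of three guards
-- shadows the president within distance one while the other two close in from ahead and
-- from behind, at cost 1 + (distance of the front guard) + (distance of the back guard);
-- stepping onto either of them only lets it and the shadow surround him.  While no guard is
-- near, two guards squeeze him from both sides, at a cost above every close-in cost.

module Submission where

open import Defs
open import Data.Bool using (Bool; true; false; T; _∨_; _∧_; not; if_then_else_)
open import Data.Bool.Properties using (T-∧)
open import Data.Empty using (⊥; ⊥-elim)
open import Data.Fin using (Fin; toℕ; fromℕ<) renaming (zero to fzero; suc to fsuc)
open import Data.Fin.Properties using (toℕ-injective; toℕ-fromℕ<; fromℕ<-toℕ; toℕ<n; any?; all?)
open import Data.List.Base as List using (List)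
open import Data.List.Extrema.Nat using (argmin; f[argmin]≤v⁺)
open import Data.List.Relation.Unary.Any using (here; there)
open import Data.Nat using (ℕ; zero; suc; _+_; _∸_; _≤_; _<_; z≤n; s≤s; _⊓_; _≤ᵇ_; _≡ᵇ_)
open import Data.Nat.Properties
open import Data.Product using (_×_; _,_; proj₁; proj₂; ∃; map₂)
open import Data.Sum as Sum using (_⊎_; inj₁; inj₂; [_,_]′; swap)
open import Data.Unit using (⊤; tt)
open import Data.Vec using (Vec; []; _∷_; head; lookup; tabulate; zipWith; map; replicate; _[_]≔_)
open import Data.Vec.Properties
  using ( lookup-zipWith; lookup-map; lookup∘update; lookup∘update′; lookup-replicate
        ; tabulate∘lookup; tabulate-∘; tabulate-cong; lookup∘tabulate)
open import Function using (_∘_)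
open import Function.Bundles using (Equivalence)
open import Relation.Binary.PropositionalEquality
open import Relation.Nullary using (¬_)
open import Relation.Nullary.Decidable using (Dec; yes; no; ¬?; T?; from-yes; map′; _×-dec_; _⊎-dec_)
open import Relation.Unary using (Decidable)

eventually-zero : (f : ℕ → ℕ) → (∀ t → f (suc t) ≤ f t ∸ 1) → ∀ t → f 0 ≤ t → f t ≡ 0
eventually-zero f descent t f0≤t = n≤0⇒n≡0 (≤-trans (below t) (≤-reflexive (m≤n⇒m∸n≡0 f0≤t)))
  where
  open ≤-Reasoning
  below : ∀ t → f t ≤ f 0 ∸ t
  below zero = ≤-refl
  below (suc t) = begin
    f (suc t)      ≤⟨ descent t ⟩
    f t ∸ 1        ≤⟨ ∸-monoˡ-≤ 1 (below t) ⟩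
    f 0 ∸ t ∸ 1    ≡⟨ ∸-+-assoc (f 0) t 1 ⟩
    f 0 ∸ (t + 1)  ≡⟨ cong (f 0 ∸_) (+-comm t 1) ⟩
    f 0 ∸ suc t    ∎

<⇒≤∸1 : ∀ {m n} → m < n → m ≤ n ∸ 1
<⇒≤∸1 (s≤s m≤n) = m≤n

tabulate-zipWith : ∀ {k} {A B C : Set} (f : A → B → C) (xs : Vec A k) (y : Fin k → B) →
                   tabulate (λ g → f (lookup xs g) (y g)) ≡ zipWith f xs (tabulate y)
tabulate-zipWith f []       y = refl
tabulate-zipWith f (x ∷ xs) y = cong (f x (y fzero) ∷_) (tabulate-zipWith f xs (y ∘ fsuc))

all³ : ∀ {a b c} → T a → T b → T c → T (a ∧ b ∧ c)
all³ p q r = Equivalence.from T-∧ (p , Equivalence.from T-∧ (q , r))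

split³ : ∀ {a b c} → T (a ∧ b ∧ c) → T a × T b × T c
split³ abc = let (p , qr) = Equivalence.to T-∧ abc in p , Equivalence.to T-∧ qr

module Strategies (G : Graph) (k : ℕ) where
  open Graph G
  open Game G k

  module Play (σ : BGStrategy) (τ : PStrategy) where
    guards : ℕ → Config
    guards t = proj₁ (head (play σ τ t))

    president : ℕ → Fin n
    president t = proj₂ (head (play σ τ t))

  module Potential
      (start : Config) (reply : Config → Fin n → Config)
      (reply-legal : ∀ b p → BGStep b (reply b p))
      (Φ : Config → Fin n → ℕ) (bound : ℕ)
      (opening : ∀ p → Φ (reply start p) p < bound)
      (progress : ∀ b p p′ → MoveOK p p′ → Φ b p < bound → Φ (reply b p′) p′ ≤ Φ b p ∸ 1)
      (Φ≡0⇒surrounded : ∀ b p → Φ b p ≡ 0 → Surrounded b p)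
      where

    σ : BGStrategy
    σ = record
      { place = start
      ; move  = λ h → reply (proj₁ (head h)) (proj₂ (head h))
      ; legal = λ h → reply-legal (proj₁ (head h)) (proj₂ (head h))
      }

    module _ (τ : PStrategy) where
      open Play σ τ

      Φ-after-guards : ℕ → ℕ
      Φ-after-guards t = Φ (guards (suc t)) (president t)

      descent : ∀ t → Φ-after-guards t < bound → Φ-after-guards (suc t) ≤ Φ-after-guards t ∸ 1
      descent t = progress (guards (suc t)) (president t) (president (suc t))
                           (PStrategy.legal τ (play σ τ t) (guards (suc t)))

      bounded : ∀ t → Φ-after-guards t < bound
      bounded zero    = opening (president 0)
      bounded (suc t) = ≤-<-trans (descent t (bounded t)) (≤-<-trans (m∸n≤m _ 1) (bounded t))

    wins : BGWins
    wins = σ , λ τ → Φ-after-guards τ 0 , λ t Φ₀≤t →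
      Φ≡0⇒surrounded _ _ (eventually-zero (Φ-after-guards τ) (λ t → descent τ t (bounded τ t)) t Φ₀≤t)

  module Evasion
      (Safe : Config → Fin n → Set) (place : Config → Fin n) (dodge : Config → Fin n → Fin n)
      (place-safe : ∀ b → Safe b (place b))
      (dodge-legal : ∀ b p → MoveOK p (dodge b p))
      (safe⇒unsurrounded : ∀ b b′ p → BGStep b b′ → Safe b p → ¬ Surrounded b′ p)
      (dodge-safe : ∀ b b′ p → BGStep b b′ → Safe b p → Safe b′ (dodge b′ p))
      where

    τ : PStrategy
    τ = record
      { place = place
      ; move  = λ h b′ → dodge b′ (proj₂ (head h))
      ; legal = λ h b′ → dodge-legal b′ (proj₂ (head h))
      }

    loses : ¬ BGWins
    loses (σ , σ-wins) with σ-wins τ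
    ... | t₀ , surrounded = safe⇒unsurrounded _ _ _ (legal t₀) (safe t₀) (surrounded t₀ ≤-refl)
      where
      open Play σ τ

      legal : ∀ t → BGStep (guards t) (guards (suc t))
      legal t = BGStrategy.legal σ (play σ τ t)

      safe : ∀ t → Safe (guards t) (president t)
      safe zero    = place-safe (guards 0)
      safe (suc t) = dodge-safe _ _ _ (legal t) (safe t)

data Step : Set where
  stay fwd bwd : Step

reverse : Step → Step
reverse stay = stay
reverse fwd  = bwd
reverse bwd  = fwd

∃-step? : {P : Step → Set} → Decidable P → Dec (∃ P)
∃-step? {P} P? = map′ from to (P? stay ⊎-dec (P? fwd ⊎-dec P? bwd))
  where
  from : P stay ⊎ P fwd ⊎ P bwd → ∃ P
  from = [ (stay ,_) , [ (fwd ,_) , (bwd ,_) ]′ ]′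
  to : ∃ P → P stay ⊎ P fwd ⊎ P bwd
  to (stay , p) = inj₁ p
  to (fwd  , p) = inj₂ (inj₁ p)
  to (bwd  , p) = inj₂ (inj₂ p)

∀-step? : {P : Step → Set} → Decidable P → Dec (∀ s → P s)
∀-step? P? = map′ (λ { (p , q , r) → λ { stay → p ; fwd → q ; bwd → r } })
                  (λ ∀P → ∀P stay , ∀P fwd , ∀P bwd)
                  (P? stay ×-dec (P? fwd ×-dec P? bwd))

∃-moves? : ∀ {k} {P : Vec Step k → Set} → Decidable P → Dec (∃ P)
∃-moves? {zero}  P? = map′ ([] ,_) (λ { ([] , p) → p }) (P? [])
∃-moves? {suc k} P? = map′ (λ { (s , ms , p) → s ∷ ms , p }) (λ { (s ∷ ms , p) → s , ms , p })
                           (∃-step? (λ s → ∃-moves? (λ ms → P? (s ∷ ms))))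

firstStep : {P : Step → Set} → Decidable P → Step
firstStep P? with ∃-step? P?
... | yes (s , _) = s
... | no _        = stay

firstStep-sound : {P : Step → Set} (P? : Decidable P) → ∃ P → P (firstStep P?)
firstStep-sound P? ∃P with ∃-step? P?
... | yes (_ , Ps) = Ps
... | no ¬∃P       = ⊥-elim (¬∃P ∃P)

greedy : ∀ {k} → (Vec Step k → ℕ) → Vec Step k
greedy {zero}  f = []
greedy {suc k} f = argmin f (extend stay) (extend fwd List.∷ extend bwd List.∷ List.[])
  where
  extend : Step → Vec Step (suc k)
  extend s = s ∷ greedy (λ ms → f (s ∷ ms))

greedy-minimal : ∀ {k} (f : Vec Step k → ℕ) ms → f (greedy f) ≤ f ms
greedy-minimal {zero}  f [] = ≤-refl
greedy-minimal {suc k} f (s ∷ ms) = ≤-trans (argmin≤ s) (greedy-minimal (λ ms → f (s ∷ ms)) ms)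
  where
  extend : Step → Vec Step (suc k)
  extend s = s ∷ greedy (λ ms → f (s ∷ ms))
  others : List (Vec Step (suc k))
  others = extend fwd List.∷ extend bwd List.∷ List.[]
  argmin≤ : ∀ s → f (greedy f) ≤ f (extend s)
  argmin≤ stay = f[argmin]≤v⁺ {f = f} (extend stay) others (inj₁ ≤-refl)
  argmin≤ fwd  = f[argmin]≤v⁺ {f = f} (extend stay) others (inj₂ (here ≤-refl))
  argmin≤ bwd  = f[argmin]≤v⁺ {f = f} (extend stay) others (inj₂ (there (here ≤-refl)))

module Residues (N : ℕ) where

  -- a residue mod suc N together with its complement; both equations are kept so that
  -- matching on either field refines the other
  record Residue : Set where
    constructor residue
    field
      up      : ℕ
      down    : ℕ
      up+down : up + down ≡ N
      down+up : down + up ≡ N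

  open Residue public

  mkResidue : ∀ a b → a + b ≡ N → Residue
  mkResidue a b a+b≡N = residue a b a+b≡N (trans (+-comm b a) a+b≡N)

  up-injective : ∀ {x y} → up x ≡ up y → x ≡ y
  up-injective {residue a b e e′} {residue .a b′ f f′} refl with +-cancelˡ-≡ a b b′ (trans e (sym f))
  ... | refl rewrite ≡-irrelevant e f | ≡-irrelevant e′ f′ = refl

  up≤N : ∀ x → up x ≤ N
  up≤N (residue a b a+b≡N _) = subst (a ≤_) a+b≡N (m≤m+n a b)

  down≤N : ∀ x → down x ≤ N
  down≤N (residue a b _ b+a≡N) = subst (b ≤_) b+a≡N (m≤m+n b a)

  zeroᴿ : Residue
  zeroᴿ = mkResidue 0 N refl

  next : Residue → Residue
  next (residue a (suc b) e _) = mkResidue (suc a) b (trans (sym (+-suc a b)) e)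
  next (residue a zero    _ _) = zeroᴿ

  prev : Residue → Residue
  prev (residue (suc a) b e _) = mkResidue a (suc b) (trans (+-suc a b) e)
  prev (residue zero    b _ _) = mkResidue N 0 (+-identityʳ N)

  next-prev : ∀ x → next (prev x) ≡ x
  next-prev (residue (suc a) b _ _) = up-injective refl
  next-prev (residue zero    b _ _) = up-injective refl

  prev-next : ∀ x → prev (next x) ≡ x
  prev-next (residue a (suc b) _ _) = up-injective refl
  prev-next (residue a zero    _ a≡N) = up-injective (sym a≡N)

  prev-injective : ∀ {x y} → prev x ≡ prev y → x ≡ y
  prev-injective {x} {y} eq = trans (sym (next-prev x)) (trans (cong next eq) (next-prev y))

  prev^ : ℕ → Residue → Residue
  prev^ zero    x = x
  prev^ (suc k) x = prev^ k (prev x)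

  prev^-prev : ∀ k x → prev^ k (prev x) ≡ prev (prev^ k x)
  prev^-prev zero    x = refl
  prev^-prev (suc k) x = prev^-prev k (prev x)

  prev^-next : ∀ k x → prev^ k (next x) ≡ next (prev^ k x)
  prev^-next zero    x = refl
  prev^-next (suc k) x = begin
    prev^ k (prev (next x))  ≡⟨ cong (prev^ k) (prev-next x) ⟩
    prev^ k x                ≡⟨ next-prev (prev^ k x) ⟨
    next (prev (prev^ k x))  ≡⟨ cong next (prev^-prev k x) ⟨
    next (prev^ k (prev x))  ∎
    where open ≡-Reasoning

  prev^-injective : ∀ k {x y} → prev^ k x ≡ prev^ k y → x ≡ y
  prev^-injective zero    eq = eq
  prev^-injective (suc k) eq = prev-injective (prev^-injective k eq)

  prev^-+ : ∀ a b x → prev^ (a + b) x ≡ prev^ b (prev^ a x)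
  prev^-+ zero    b x = refl
  prev^-+ (suc a) b x = prev^-+ a b (prev x)

  up-prev^ : ∀ k x → k ≤ up x → up (prev^ k x) ≡ up x ∸ k
  up-prev^ zero    x                       _         = refl
  up-prev^ (suc k) (residue (suc a) b _ _) (s≤s k≤a) = up-prev^ k (mkResidue a (suc b) _) k≤a

  prev^-up : ∀ x → prev^ (up x) x ≡ zeroᴿ
  prev^-up x = up-injective (trans (up-prev^ (up x) x ≤-refl) (n∸n≡0 (up x)))

  prev^-cycle : ∀ x → prev^ (suc N) x ≡ x
  prev^-cycle x@(residue a b a+b≡N b+a≡N) = begin
    prev^ (suc N) x                  ≡⟨ cong (λ k → prev^ k x) a+1+b≡1+N ⟨
    prev^ (a + suc b) x              ≡⟨ prev^-+ a (suc b) x ⟩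
    prev^ (suc b) (prev^ a x)        ≡⟨ cong (prev^ (suc b)) (prev^-up x) ⟩
    prev^ b (prev zeroᴿ)             ≡⟨ up-injective up-prev^-b ⟩
    x                                ∎
    where
    open ≡-Reasoning
    a+1+b≡1+N : a + suc b ≡ suc N
    a+1+b≡1+N = trans (+-suc a b) (cong suc a+b≡N)
    up-prev^-b : up (prev^ b (prev zeroᴿ)) ≡ a
    up-prev^-b = trans (up-prev^ b (prev zeroᴿ) (down≤N x))
                       (trans (cong (_∸ b) (sym b+a≡N)) (m+n∸m≡n b a))

  Vertex : Set
  Vertex = Fin (suc N)

  toResidue : Vertex → Residue
  toResidue v = mkResidue (toℕ v) (N ∸ toℕ v) (m+[n∸m]≡n (≤-pred (toℕ<n v)))

  fromResidue : Residue → Vertex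
  fromResidue x = fromℕ< (s≤s (up≤N x))

  toResidue-fromResidue : ∀ x → toResidue (fromResidue x) ≡ x
  toResidue-fromResidue x = up-injective (toℕ-fromℕ< _)

  fromResidue-toResidue : ∀ v → fromResidue (toResidue v) ≡ v
  fromResidue-toResidue v = fromℕ<-toℕ v _

  toResidue-injective : ∀ {v w} → toResidue v ≡ toResidue w → v ≡ w
  toResidue-injective eq = toℕ-injective (cong up eq)

  ∀-residue? : {P : Residue → Set} → Decidable P → Dec (∀ x → P x)
  ∀-residue? {P} P? = map′ (λ ∀P x → subst P (toResidue-fromResidue x) (∀P (fromResidue x)))
                           (λ ∀P v → ∀P (toResidue v)) (all? (λ v → P? (toResidue v)))

  shift : Step → Residue → Residue
  shift stay x = x
  shift fwd  x = next x
  shift bwd  x = prev x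

  move : Step → Vertex → Vertex
  move s v = fromResidue (shift s (toResidue v))

  toResidue-move : ∀ s v → toResidue (move s v) ≡ shift s (toResidue v)
  toResidue-move s v = toResidue-fromResidue _

  prev^-shift : ∀ k s x → prev^ k (shift s x) ≡ shift s (prev^ k x)
  prev^-shift k stay x = refl
  prev^-shift k fwd  x = prev^-next k x
  prev^-shift k bwd  x = prev^-prev k x

  prev^-up-shift : ∀ s p x → prev^ (up (shift s p)) x ≡ shift (reverse s) (prev^ (up p) x)
  prev^-up-shift stay p x = refl
  prev^-up-shift fwd (residue a (suc b) _ _) x = prev^-prev a x
  prev^-up-shift fwd (residue a zero _ refl) x = begin
    x                   ≡⟨ prev^-cycle x ⟨
    prev^ a (prev x)    ≡⟨ prev^-prev a x ⟩
    prev (prev^ a x)    ∎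
    where open ≡-Reasoning
  prev^-up-shift bwd (residue (suc a) b _ _) x = begin
    prev^ a x               ≡⟨ next-prev (prev^ a x) ⟨
    next (prev (prev^ a x)) ≡⟨ cong next (prev^-prev a x) ⟨
    next (prev^ a (prev x)) ∎
    where open ≡-Reasoning
  prev^-up-shift bwd (residue zero b _ _) x = begin
    prev^ N x                ≡⟨ next-prev (prev^ N x) ⟨
    next (prev (prev^ N x))  ≡⟨ cong next (prev^-prev N x) ⟨
    next (prev^ (suc N) x)   ≡⟨ cong next (prev^-cycle x) ⟩
    next x                   ∎
    where open ≡-Reasoning

  infixl 6 _⊖_
  _⊖_ : Vertex → Vertex → Residue
  v ⊖ p = prev^ (toℕ p) (toResidue v)

  ⊖-injectiveˡ : ∀ {v w p} → v ⊖ p ≡ w ⊖ p → v ≡ w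
  ⊖-injectiveˡ {p = p} eq = toResidue-injective (prev^-injective (toℕ p) eq)

  ⊖-self : ∀ p → p ⊖ p ≡ zeroᴿ
  ⊖-self p = prev^-up (toResidue p)

  move-⊖ : ∀ s v p → move s v ⊖ p ≡ shift s (v ⊖ p)
  move-⊖ s v p = trans (cong (prev^ (toℕ p)) (toResidue-move s v)) (prev^-shift (toℕ p) s (toResidue v))

  ⊖-move : ∀ s v p → v ⊖ move s p ≡ shift (reverse s) (v ⊖ p)
  ⊖-move s v p = trans (cong (λ x → prev^ (up x) (toResidue v)) (toResidue-move s p))
                       (prev^-up-shift s (toResidue p) (toResidue v))

  -- CycleAdj (suc N) v w unfolds to Adjacent (toResidue v) (toResidue w)
  Adjacent : Residue → Residue → Set
  Adjacent x y = (up y ≡ suc (up x)) ⊎ (up x ≡ suc (up y))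
               ⊎ ((up x ≡ 0 × suc (up y) ≡ suc N) ⊎ (up y ≡ 0 × suc (up x) ≡ suc N))

  adjacent-next : ∀ x → Adjacent x (next x)
  adjacent-next (residue a (suc b) _ _) = inj₁ refl
  adjacent-next (residue a zero _ a≡N)  = inj₂ (inj₂ (inj₂ (refl , cong suc a≡N)))

  adjacent-prev : ∀ x → Adjacent x (prev x)
  adjacent-prev (residue (suc a) b _ _) = inj₂ (inj₁ refl)
  adjacent-prev (residue zero b _ _)    = inj₂ (inj₂ (inj₁ (refl , refl)))

  adjacent⇒next⊎prev : ∀ x y → Adjacent x y → y ≡ next x ⊎ y ≡ prev x
  adjacent⇒next⊎prev (residue a (suc b) _ _) y (inj₁ eq) = inj₁ (up-injective eq)
  adjacent⇒next⊎prev (residue a zero _ refl) y (inj₁ eq) = ⊥-elim (<-irrefl eq (s≤s (up≤N y)))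
  adjacent⇒next⊎prev (residue (suc a) b _ _) y (inj₂ (inj₁ eq)) = inj₂ (up-injective (sym (suc-injective eq)))
  adjacent⇒next⊎prev (residue (suc a) b _ _) y (inj₂ (inj₂ (inj₁ (() , _))))
  adjacent⇒next⊎prev (residue zero b _ _) y (inj₂ (inj₂ (inj₁ (_ , eq)))) = inj₂ (up-injective (suc-injective eq))
  adjacent⇒next⊎prev (residue a (suc b) a+1+b≡N _) y (inj₂ (inj₂ (inj₂ (_ , eq)))) =
    ⊥-elim (m+1+n≢m a (trans a+1+b≡N (sym (suc-injective eq))))
  adjacent⇒next⊎prev (residue a zero _ _) y (inj₂ (inj₂ (inj₂ (eq , _)))) = inj₁ (up-injective eq)

  adjacent-move-fwd : ∀ v → CycleAdj (suc N) v (move fwd v)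
  adjacent-move-fwd v = subst (Adjacent (toResidue v)) (sym (toResidue-move fwd v)) (adjacent-next (toResidue v))

  adjacent-move-bwd : ∀ v → CycleAdj (suc N) v (move bwd v)
  adjacent-move-bwd v = subst (Adjacent (toResidue v)) (sym (toResidue-move bwd v)) (adjacent-prev (toResidue v))

  adjacent⇒move : ∀ v w → CycleAdj (suc N) v w → w ≡ move fwd v ⊎ w ≡ move bwd v
  adjacent⇒move v w adj with adjacent⇒next⊎prev (toResidue v) (toResidue w) adj
  ... | inj₁ eq = inj₁ (toResidue-injective (trans eq (sym (toResidue-move fwd v))))
  ... | inj₂ eq = inj₂ (toResidue-injective (trans eq (sym (toResidue-move bwd v))))

  View : ℕ → Set
  View k = Vec Residue k

  ∀-view? : ∀ {k} {P : View k → Set} → Decidable P → Dec (∀ r → P r)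
  ∀-view? {zero}  P? = map′ (λ p → λ { [] → p }) (λ ∀P → ∀P []) (P? [])
  ∀-view? {suc k} P? = map′ (λ ∀P → λ { (x ∷ r) → ∀P x r }) (λ ∀P x r → ∀P (x ∷ r))
                            (∀-residue? (λ x → ∀-view? (λ r → P? (x ∷ r))))

  guardsStep : ∀ {k} → Vec Step k → View k → View k
  guardsStep = zipWith shift

  -- in the president's coordinates, his step forward moves every guard one step back
  presidentStep : ∀ {k} → Step → View k → View k
  presidentStep s = map (shift (reverse s))

  lookup-guardsStep : ∀ {k} ms (r : View k) g → lookup (guardsStep ms r) g ≡ shift (lookup ms g) (lookup r g)
  lookup-guardsStep ms r g = lookup-zipWith shift g ms r

  lookup-presidentStep : ∀ {k} s (r : View k) g → lookup (presidentStep s r) g ≡ shift (reverse s) (lookup r g)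
  lookup-presidentStep s r g = lookup-map g (shift (reverse s)) r

  Ahead : Residue → Set
  Ahead x = up x ≡ 1

  Behind : Residue → Set
  Behind x = down x ≡ 0

  Surrounds : ∀ {k} → View k → Set
  Surrounds r = (∃ λ g → Ahead (lookup r g)) × (∃ λ g → Behind (lookup r g))

  surrounds? : ∀ {k} → Decidable (Surrounds {k})
  surrounds? r = any? (λ g → up (lookup r g) ≟ 1) ×-dec any? (λ g → down (lookup r g) ≟ 0)

  Trapped : ∀ {k} → View k → Set
  Trapped r = ∀ s → ∃ λ ms → Surrounds (guardsStep ms (presidentStep s r))

  trapped? : ∀ {k} → Decidable (Trapped {k})
  trapped? r = ∀-step? (λ s → ∃-moves? (λ ms → surrounds? (guardsStep ms (presidentStep s r))))

  TrapReachable : ∀ {k} → View k → Set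
  TrapReachable r = ∃ λ ms → Surrounds (guardsStep ms r) ⊎ Trapped (guardsStep ms r)

  trapReachable? : ∀ {k} → Decidable (TrapReachable {k})
  trapReachable? r = ∃-moves? (λ ms → surrounds? (guardsStep ms r) ⊎-dec trapped? (guardsStep ms r))

module Surrounding (m : ℕ) where
  open Residues (2 + m)

  ahead-not-behind : ∀ {x} → Ahead x → Behind x → ⊥
  ahead-not-behind {residue _ _ () _} refl refl

  behind⇒up≡N : ∀ {x} → Behind x → up x ≡ 2 + m
  behind⇒up≡N {residue _ _ _ a≡N} refl = a≡N

  ahead-unique : ∀ {x y} → Ahead x → Ahead y → x ≡ y
  ahead-unique p q = up-injective (trans p (sym q))

  behind-unique : ∀ {x y} → Behind x → Behind y → x ≡ y
  behind-unique {x} {y} p q = up-injective (trans (behind⇒up≡N {x} p) (sym (behind⇒up≡N {y} q)))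

  ahead-move-fwd : ∀ p → Ahead (move fwd p ⊖ p)
  ahead-move-fwd p = cong up (trans (move-⊖ fwd p p) (cong next (⊖-self p)))

  behind-move-bwd : ∀ p → Behind (move bwd p ⊖ p)
  behind-move-bwd p = cong down (trans (move-⊖ bwd p p) (cong prev (⊖-self p)))

  surrounds⇒2≤k : ∀ {k} (r : View k) → Surrounds r → 2 ≤ k
  surrounds⇒2≤k {1}           (x ∷ []) ((fzero , ahead) , (fzero , behind)) =
    ⊥-elim (ahead-not-behind {x} ahead behind)
  surrounds⇒2≤k {suc (suc k)} r _ = s≤s (s≤s z≤n)

  canReachAhead : Residue → Bool
  canReachAhead x = up x ≤ᵇ 2

  canReachBehind : Residue → Bool
  canReachBehind x = (up x ≡ᵇ 0) ∨ (down x ≤ᵇ 1)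

  reachAhead : ∀ x → T (canReachAhead x) → ∃ λ s → Ahead (shift s x)
  reachAhead (residue 0 (suc b) _ _) _ = fwd , refl
  reachAhead (residue 1 b _ _)       _ = stay , refl
  reachAhead (residue 2 b _ _)       _ = bwd , refl

  reachBehind : ∀ x → T (canReachBehind x) → ∃ λ s → Behind (shift s x)
  reachBehind (residue 0 b _ _)       _ = bwd , refl
  reachBehind (residue (suc a) 0 _ _) _ = stay , refl
  reachBehind (residue (suc a) 1 _ _) _ = fwd , refl

  ahead⇒canReachAhead : ∀ s x → Ahead (shift s x) → T (canReachAhead x)
  ahead⇒canReachAhead stay (residue 1 _ _ _)       refl = _
  ahead⇒canReachAhead fwd  (residue 0 (suc _) _ _) refl = _
  ahead⇒canReachAhead fwd  (residue _ zero _ _)    ()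
  ahead⇒canReachAhead bwd  (residue 2 _ _ _)       refl = _
  ahead⇒canReachAhead bwd  (residue 0 _ _ _)       ()

  behind⇒canReachBehind : ∀ s x → Behind (shift s x) → T (canReachBehind x)
  behind⇒canReachBehind stay (residue (suc _) 0 _ _)       refl = _
  behind⇒canReachBehind fwd  (residue 0 1 _ _)             refl = _
  behind⇒canReachBehind fwd  (residue (suc _) 1 _ _)       refl = _
  behind⇒canReachBehind fwd  (residue _ 0 _ _)             ()
  behind⇒canReachBehind bwd  (residue 0 _ _ _)             refl = _
  behind⇒canReachBehind bwd  (residue (suc _) _ _ _)       ()

  ahead-reachable : ∀ {x} → Ahead x → ∀ s → T (canReachAhead (shift s x))
  ahead-reachable {residue 1 (suc b) _ _} refl stay = _
  ahead-reachable {residue 1 (suc b) _ _} refl fwd  = _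
  ahead-reachable {residue 1 b _ _}       refl bwd  = _

  behind-reachable : ∀ {x} → Behind x → ∀ s → T (canReachBehind (shift s x))
  behind-reachable {residue (suc a) 0 _ _}       refl stay = _
  behind-reachable {residue (suc a) 0 _ _}       refl fwd  = _
  behind-reachable {residue (suc (suc a)) 0 _ _} refl bwd  = _

  surrounds-stable : ∀ {k} (r : View k) s → Surrounds r → ∃ λ ms → Surrounds (guardsStep ms (presidentStep s r))
  surrounds-stable {k} r s ((g , ahead) , (g′ , behind)) = ms , (g , ahead′) , (g′ , behind′)
    where
    r′ : View k
    r′ = presidentStep s r
    reach : ∃ λ t → Ahead (shift t (lookup r′ g))
    reach = reachAhead _ (subst (T ∘ canReachAhead) (sym (lookup-presidentStep s r g))
                                (ahead-reachable ahead (reverse s)))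
    reach′ : ∃ λ t → Behind (shift t (lookup r′ g′))
    reach′ = reachBehind _ (subst (T ∘ canReachBehind) (sym (lookup-presidentStep s r g′))
                                  (behind-reachable {lookup r g′} behind (reverse s)))
    g≢g′ : g ≢ g′
    g≢g′ refl = ahead-not-behind {lookup r g} ahead behind
    ms₁ : Vec Step k
    ms₁ = replicate k stay [ g ]≔ proj₁ reach
    ms : Vec Step k
    ms = ms₁ [ g′ ]≔ proj₁ reach′
    ahead′ : Ahead (lookup (guardsStep ms r′) g)
    ahead′ = subst Ahead (sym (trans (lookup-guardsStep ms r′ g)
               (cong (λ t → shift t (lookup r′ g))
                     (trans (lookup∘update′ g≢g′ ms₁ (proj₁ reach′))
                            (lookup∘update g (replicate k stay) (proj₁ reach))))))
               (proj₂ reach)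
    behind′ : Behind (lookup (guardsStep ms r′) g′)
    behind′ = subst Behind (sym (trans (lookup-guardsStep ms r′ g′)
               (cong (λ t → shift t (lookup r′ g′)) (lookup∘update g′ ms₁ (proj₁ reach′)))))
               (proj₂ reach′)

module CycleGame (m : ℕ) (h : 3 ≤ 3 + m) (k : ℕ) where
  open Residues (2 + m)
  open Surrounding m
  open Game (Cycle (3 + m) h) k public
  open Strategies (Cycle (3 + m) h) k

  view : Config → Vertex → View k
  view b p = tabulate (λ g → b g ⊖ p)

  moveGuards : Vec Step k → Config → Config
  moveGuards ms b g = move (lookup ms g) (b g)

  moveOK-move : ∀ s v → MoveOK v (move s v)
  moveOK-move stay v = inj₁ (sym (fromResidue-toResidue v))
  moveOK-move fwd  v = inj₂ (adjacent-move-fwd v)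
  moveOK-move bwd  v = inj₂ (adjacent-move-bwd v)

  moveOK⇒move : ∀ {v w} → MoveOK v w → ∃ λ s → w ≡ move s v
  moveOK⇒move         (inj₁ refl) = stay , sym (fromResidue-toResidue _)
  moveOK⇒move {v} {w} (inj₂ adj)  = [ (fwd ,_) , (bwd ,_) ]′ (adjacent⇒move v w adj)

  moveGuards-legal : ∀ ms b → BGStep b (moveGuards ms b)
  moveGuards-legal ms b g = moveOK-move (lookup ms g) (b g)

  view-moveGuards : ∀ ms b p → view (moveGuards ms b) p ≡ guardsStep ms (view b p)
  view-moveGuards ms b p = trans (tabulate-cong (λ g → move-⊖ (lookup ms g) (b g) p))
                                 (tabulate-zipWith shift ms (λ g → b g ⊖ p))

  view-move : ∀ s b p → view b (move s p) ≡ presidentStep s (view b p)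
  view-move s b p = trans (tabulate-cong (λ g → ⊖-move s (b g) p)) (tabulate-∘ (shift (reverse s)) (λ g → b g ⊖ p))

  view-BGStep : ∀ {b b′} → BGStep b b′ → ∃ λ ms → ∀ p → view b′ p ≡ guardsStep ms (view b p)
  view-BGStep {b} {b′} step = ms , λ p → trans (tabulate-cong (λ g → cong (_⊖ p) (moved g))) (view-moveGuards ms b p)
    where
    ms : Vec Step k
    ms = tabulate (λ g → proj₁ (moveOK⇒move (step g)))
    moved : ∀ g → b′ g ≡ moveGuards ms b g
    moved g = trans (proj₂ (moveOK⇒move (step g))) (cong (λ s → move s (b g)) (sym (lookup∘tabulate _ g)))

  view-const : ∀ v p → view (λ _ → v) p ≡ replicate k (v ⊖ p)
  view-const v p = trans (tabulate-cong (λ g → sym (lookup-replicate g (v ⊖ p)))) (tabulate∘lookup (replicate k (v ⊖ p)))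

  lookup-view : ∀ b p g → lookup (view b p) g ≡ b g ⊖ p
  lookup-view b p g = lookup∘tabulate (λ g → b g ⊖ p) g

  surrounds⇒surrounded : ∀ b p → Surrounds (view b p) → Surrounded b p
  surrounds⇒surrounded b p ((g , ahead) , (g′ , behind)) w adj with adjacent⇒move p w adj
  ... | inj₁ refl = g  , ⊖-injectiveˡ {p = p} (ahead-unique {b g ⊖ p} {move fwd p ⊖ p}
                          (subst Ahead (lookup-view b p g) ahead) (ahead-move-fwd p))
  ... | inj₂ refl = g′ , ⊖-injectiveˡ {p = p} (behind-unique {b g′ ⊖ p} {move bwd p ⊖ p}
                          (subst Behind (lookup-view b p g′) behind) (behind-move-bwd p))

  surrounded⇒surrounds : ∀ b p → Surrounded b p → Surrounds (view b p)
  surrounded⇒surrounds b p surrounded = occupied {Ahead} (move fwd p) (adjacent-move-fwd p) (ahead-move-fwd p) ,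
                                        occupied {Behind} (move bwd p) (adjacent-move-bwd p) (behind-move-bwd p)
    where
    occupied : ∀ {P : Residue → Set} v → CycleAdj (3 + m) p v → P (v ⊖ p) → ∃ λ g → P (lookup (view b p) g)
    occupied {P} v adj Pv with surrounded v adj
    ... | g , refl = g , subst P (sym (lookup-view b p g)) Pv

  module ByCost
      (cost : View k → ℕ) (bound : ℕ) (cost-positive : ∀ r → 1 ≤ cost r)
      (opening : ∀ x → ∃ λ ms → cost (guardsStep ms (replicate k x)) < bound)
      (progress : ∀ r s → cost r < bound → ∃ λ ms →
                    Surrounds (guardsStep ms (presidentStep s r)) ⊎ cost (guardsStep ms (presidentStep s r)) < cost r)
      where

    Φ : View k → ℕ
    Φ r with surrounds? r
    ... | yes _ = 0
    ... | no  _ = cost r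

    Φ≤cost : ∀ r → Φ r ≤ cost r
    Φ≤cost r with surrounds? r
    ... | yes _ = z≤n
    ... | no  _ = ≤-refl

    Φ-surrounds : ∀ r → Surrounds r → Φ r ≡ 0
    Φ-surrounds r surr with surrounds? r
    ... | yes _    = refl
    ... | no ¬surr = ⊥-elim (¬surr surr)

    Φ≡0⇒surrounds : ∀ r → Φ r ≡ 0 → Surrounds r
    Φ≡0⇒surrounds r Φr≡0 with surrounds? r
    ... | yes surr = surr
    ... | no  _    = ⊥-elim (<-irrefl (sym Φr≡0) (cost-positive r))

    improvable : ∀ r s → Φ r < bound → ∃ λ ms → Φ (guardsStep ms (presidentStep s r)) ≤ Φ r ∸ 1
    improvable r s Φr<bound with surrounds? r
    ... | yes surr = map₂ (λ surr′ → ≤-reflexive (Φ-surrounds _ surr′)) (surrounds-stable r s surr)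
    ... | no ¬surr = map₂ [ (λ surr′ → subst (_≤ cost r ∸ 1) (sym (Φ-surrounds _ surr′)) z≤n)
                          , (λ lt → ≤-trans (Φ≤cost _) (<⇒≤∸1 lt)) ]′
                          (progress r s Φr<bound)

    -- greedy play does at least as well as any move promised by `progress`
    greedyMoves : Config → Vertex → Vec Step k
    greedyMoves b p = greedy (λ ms → Φ (guardsStep ms (view b p)))

    reply : Config → Vertex → Config
    reply b p = moveGuards (greedyMoves b p) b

    reply-greedy : ∀ b p ms → Φ (view (reply b p) p) ≤ Φ (guardsStep ms (view b p))
    reply-greedy b p ms = subst (_≤ Φ (guardsStep ms (view b p))) (cong Φ (sym (view-moveGuards _ b p)))
                                (greedy-minimal (λ ms → Φ (guardsStep ms (view b p))) ms)

    start : Config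
    start _ = fzero

    opening′ : ∀ p → Φ (view (reply start p) p) < bound
    opening′ p =
      let (ms , lt) = opening (fzero ⊖ p)
      in ≤-<-trans (reply-greedy start p ms)
           (subst (λ r → Φ (guardsStep ms r) < bound) (sym (view-const fzero p)) (≤-<-trans (Φ≤cost _) lt))

    progress′ : ∀ b p p′ → MoveOK p p′ → Φ (view b p) < bound → Φ (view (reply b p′) p′) ≤ Φ (view b p) ∸ 1
    progress′ b p p′ ok lt =
      let (s , p′≡) = moveOK⇒move ok
          (ms , le) = improvable (view b p) s lt
      in ≤-trans (reply-greedy b p′ ms)
           (subst (λ r → Φ (guardsStep ms r) ≤ Φ (view b p) ∸ 1)
                  (sym (trans (cong (view b) p′≡) (view-move s b p))) le)

    wins : BGWins
    wins = Potential.wins start reply (λ b p → moveGuards-legal (greedyMoves b p) b)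
                          (λ b p → Φ (view b p)) bound opening′ progress′
                          (λ b p Φ≡0 → surrounds⇒surrounded b p (Φ≡0⇒surrounds _ Φ≡0))

  module ByInvariant
      (Safe : View k → Set) (safe? : Decidable Safe) (place : Config → Vertex)
      (place-safe : ∀ b → Safe (view b (place b)))
      (safe⇒unsurrounded : ∀ r ms → Safe r → ¬ Surrounds (guardsStep ms r))
      (escape : ∀ r → ¬ Surrounds r → ∃ λ s → Safe (presidentStep s r))
      where

    dodgeStep : Config → Vertex → Step
    dodgeStep b p = firstStep (λ s → safe? (presidentStep s (view b p)))

    dodge : Config → Vertex → Vertex
    dodge b p = move (dodgeStep b p) p

    unsurrounded : ∀ b b′ p → BGStep b b′ → Safe (view b p) → ¬ Surrounds (view b′ p)
    unsurrounded b b′ p step safe =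
      let (ms , view-b′) = view-BGStep step
      in subst (λ r → ¬ Surrounds r) (sym (view-b′ p)) (safe⇒unsurrounded (view b p) ms safe)

    loses : ¬ BGWins
    loses = Evasion.loses (λ b p → Safe (view b p)) place dodge place-safe (λ b p → moveOK-move (dodgeStep b p) p)
              (λ b b′ p step safe surrounded → unsurrounded b b′ p step safe (surrounded⇒surrounds b′ p surrounded))
              (λ b b′ p step safe → subst Safe (sym (view-move (dodgeStep b′ p) b′ p))
                 (firstStep-sound (λ s → safe? (presidentStep s (view b′ p)))
                                  (escape (view b′ p) (unsurrounded b b′ p step safe))))

  fewer-than-two-lose : k < 2 → ¬ BGWins
  fewer-than-two-lose k<2 = ByInvariant.loses (λ _ → ⊤) (λ _ → yes tt) (λ _ → fzero) _
    (λ r ms _ surr → <⇒≱ k<2 (surrounds⇒2≤k (guardsStep ms r) surr)) (λ _ _ → stay , tt)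

  trapCost : View k → ℕ
  trapCost r with trapped? r
  ... | yes _ = 1
  ... | no  _ = 2

  trapReachable⇒wins : (∀ r → TrapReachable r) → BGWins
  trapReachable⇒wins trap = ByCost.wins trapCost 3 positive (λ _ → replicate k stay , s≤s (trapCost≤2 _)) progress
    where
    positive : ∀ r → 1 ≤ trapCost r
    positive r with trapped? r
    ... | yes _ = s≤s z≤n
    ... | no  _ = s≤s z≤n
    trapCost≤2 : ∀ r → trapCost r ≤ 2
    trapCost≤2 r with trapped? r
    ... | yes _ = s≤s z≤n
    ... | no  _ = ≤-refl
    progress : ∀ r s → trapCost r < 3 → ∃ λ ms →
                 Surrounds (guardsStep ms (presidentStep s r)) ⊎ trapCost (guardsStep ms (presidentStep s r)) < trapCost r
    progress r s _ with trapped? r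
    ... | yes trapped = map₂ inj₁ (trapped s)
    ... | no  _       = map₂ (Sum.map₂ trapCost<2) (trap (presidentStep s r))
      where
      trapCost<2 : ∀ {r′} → Trapped r′ → trapCost r′ < 2
      trapCost<2 {r′} trapped′ with trapped? r′
      ... | yes _ = ≤-refl
      ... | no ¬t = ⊥-elim (¬t trapped′)

module TwoGuardsLose (m : ℕ) (h : 3 ≤ 6 + m) where
  open Residues (5 + m)
  open Surrounding (3 + m)
  open CycleGame (3 + m) h 2

  Threatened : View 2 → Set
  Threatened (a ∷ b ∷ []) = (T (canReachAhead a) × T (canReachBehind b))
                          ⊎ (T (canReachAhead b) × T (canReachBehind a))

  Safe : View 2 → Set
  Safe r = ¬ Threatened r

  threatened? : Decidable Threatened
  threatened? (a ∷ b ∷ []) = (T? _ ×-dec T? _) ⊎-dec (T? _ ×-dec T? _)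

  safe⇒unsurrounded : ∀ r ms → Safe r → ¬ Surrounds (guardsStep ms r)
  safe⇒unsurrounded (a ∷ b ∷ []) (x ∷ y ∷ []) safe surr with surr
  ... | (fzero , ah) , (fzero , bh) = ahead-not-behind {shift x a} ah bh
  ... | (fsuc fzero , ah) , (fsuc fzero , bh) = ahead-not-behind {shift y b} ah bh
  ... | (fzero , ah) , (fsuc fzero , bh) =
    safe (inj₁ (ahead⇒canReachAhead x a ah , behind⇒canReachBehind y b bh))
  ... | (fsuc fzero , ah) , (fzero , bh) =
    safe (inj₂ (ahead⇒canReachAhead y b ah , behind⇒canReachBehind x a bh))

  dodge-threat : ∀ a b → T (canReachAhead a) → T (canReachBehind b) → ¬ (Ahead a × Behind b) →
                 ∃ λ s → Safe (presidentStep s (a ∷ b ∷ []))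
  dodge-threat (residue 0 _ _ _) (residue 0 _ _ _)           _ _ _ = fwd , λ { (inj₁ (() , _)) ; (inj₂ (() , _)) }
  dodge-threat (residue 0 _ _ _) (residue (suc _) 0 _ refl)  _ _ _ = fwd , λ { (inj₁ (() , _)) ; (inj₂ (() , _)) }
  dodge-threat (residue 0 _ _ _) (residue (suc _) 1 _ refl)  _ _ _ = fwd , λ { (inj₁ (() , _)) ; (inj₂ (() , _)) }
  dodge-threat (residue 1 _ refl _) (residue 0 _ refl _)     _ _ _ = bwd , λ { (inj₁ (_ , ())) ; (inj₂ (_ , ())) }
  dodge-threat (residue 1 _ _ _) (residue (suc _) 0 _ _)     _ _ ¬surr = ⊥-elim (¬surr (refl , refl))
  dodge-threat (residue 1 _ _ _) (residue (suc _) 1 _ refl)  _ _ _ = fwd , λ { (inj₁ (_ , ())) ; (inj₂ (() , _)) }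
  dodge-threat (residue 2 _ refl _) b                        _ _ _ = bwd , λ { (inj₁ (() , _)) ; (inj₂ (_ , ())) }

  escape : ∀ r → ¬ Surrounds r → ∃ λ s → Safe (presidentStep s r)
  escape (a ∷ b ∷ []) ¬surr with threatened? (a ∷ b ∷ [])
  ... | no safe = stay , safe
  ... | yes (inj₁ (p , q)) = dodge-threat a b p q (λ (ah , bh) → ¬surr ((fzero , ah) , (fsuc fzero , bh)))
  ... | yes (inj₂ (p , q)) = map₂ (_∘ swap) (dodge-threat b a p q (λ (ah , bh) → ¬surr ((fsuc fzero , ah) , (fzero , bh))))

  place : Config → Vertex
  place b = move fwd (move fwd (move fwd (b fzero)))

  place-safe : ∀ b → Safe (view b (place b))
  place-safe b = subst (λ x → Safe (x ∷ b (fsuc fzero) ⊖ place b ∷ [])) (sym three-behind)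
                       λ { (inj₁ (() , _)) ; (inj₂ (_ , ())) }
    where
    open ≡-Reasoning
    b₀ : Vertex
    b₀ = b fzero
    three-behind : b₀ ⊖ place b ≡ prev (prev (prev zeroᴿ))
    three-behind = begin
      b₀ ⊖ move fwd (move fwd (move fwd b₀))  ≡⟨ ⊖-move fwd b₀ (move fwd (move fwd b₀)) ⟩
      prev (b₀ ⊖ move fwd (move fwd b₀))      ≡⟨ cong prev (⊖-move fwd b₀ (move fwd b₀)) ⟩
      prev (prev (b₀ ⊖ move fwd b₀))          ≡⟨ cong (prev ∘ prev) (⊖-move fwd b₀ b₀) ⟩
      prev (prev (prev (b₀ ⊖ b₀)))            ≡⟨ cong (prev ∘ prev ∘ prev) (⊖-self b₀) ⟩
      prev (prev (prev zeroᴿ))                ∎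

  loses : ¬ BGWins
  loses = ByInvariant.loses Safe (¬? ∘ threatened?) place place-safe safe⇒unsurrounded escape

module ThreeGuardsWin (m : ℕ) (h : 3 ≤ 6 + m) where
  open Residues (5 + m)
  open Surrounding (3 + m)
  open CycleGame (3 + m) h 3

  N : ℕ
  N = 5 + m

  isNear : Residue → Bool
  isNear x = (up x ≤ᵇ 1) ∨ (down x ≡ᵇ 0)

  isFar : Residue → Bool
  isFar x = not (isNear x)

  isApart : Residue → Bool
  isApart x = not (up x ≡ᵇ 0)

  approachBase : ℕ
  approachBase = 2 + N + N

  bound : ℕ
  bound = approachBase + approachBase

  -- a plan that does not apply costs `bound`, which the potential never reaches
  costIf : Bool → ℕ → ℕ
  costIf b c = if b then c else bound

  approachApplies : View 3 → Bool
  approachApplies (a ∷ b ∷ c ∷ []) = isFar a ∧ isFar b ∧ isFar c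

  -- all guards far: the first closes in from ahead, the second from behind
  approachCost : View 3 → ℕ
  approachCost r@(a ∷ b ∷ c ∷ []) = costIf (approachApplies r) (approachBase + (up a + down b))

  closeInApplies : View 3 → Bool
  closeInApplies (g ∷ u ∷ v ∷ []) = isNear g ∧ isApart u ∧ isApart v

  -- the first guard shadows the president, the second closes in from ahead, the third from behind
  closeInCost : View 3 → ℕ
  closeInCost r@(g ∷ u ∷ v ∷ []) = costIf (closeInApplies r) (suc (up u + down v))

  costIf-applies : ∀ {b} c → T b → costIf b c ≡ c
  costIf-applies {true} c _ = refl

  costIf<bound⇒applies : ∀ b {c} → costIf b c < bound → T b
  costIf<bound⇒applies true  _  = _
  costIf<bound⇒applies false lt = ⊥-elim (<-irrefl refl lt)

  costIf-positive : ∀ b {c} → 1 ≤ c → 1 ≤ costIf b c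
  costIf-positive true  1≤c = 1≤c
  costIf-positive false _   = s≤s z≤n

  near-or-far : ∀ x → T (isNear x) ⊎ T (isFar x)
  near-or-far x with isNear x
  ... | true  = inj₁ _
  ... | false = inj₂ _

  ahead⇒near : ∀ {x} → Ahead x → T (isNear x)
  ahead⇒near {residue 1 _ _ _} refl = _

  behind⇒near : ∀ {x} → Behind x → T (isNear x)
  behind⇒near {residue 0 0 _ _}             refl = _
  behind⇒near {residue 1 0 _ _}             refl = _
  behind⇒near {residue (suc (suc _)) 0 _ _} refl = _

  up+down≤N+N : ∀ x y → up x + down y ≤ N + N
  up+down≤N+N x y = +-mono-≤ (up≤N x) (down≤N y)

  closeInCost<approachBase : ∀ r → T (closeInApplies r) → closeInCost r < approachBase
  closeInCost<approachBase r@(g ∷ u ∷ v ∷ []) applies =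
    subst (_< approachBase) (sym (costIf-applies _ applies)) (s≤s (s≤s (up+down≤N+N u v)))

  approachCost<bound : ∀ r → T (approachApplies r) → approachCost r < bound
  approachCost<bound r@(a ∷ b ∷ c ∷ []) applies =
    subst (_< bound) (sym (costIf-applies _ applies))
          (+-monoʳ-< approachBase (s≤s (≤-trans (up+down≤N+N a b) (n≤1+n _))))

  data Role : Set where
    first second third : Role

  -- any of the three guards may be the shadow
  byRole : ∀ {A : Set} → Role → Vec A 3 → Vec A 3
  byRole first  (a ∷ b ∷ c ∷ []) = a ∷ b ∷ c ∷ []
  byRole second (a ∷ b ∷ c ∷ []) = b ∷ a ∷ c ∷ []
  byRole third  (a ∷ b ∷ c ∷ []) = c ∷ a ∷ b ∷ []

  fromRole : ∀ {A : Set} → Role → Vec A 3 → Vec A 3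
  fromRole first  (x ∷ y ∷ z ∷ []) = x ∷ y ∷ z ∷ []
  fromRole second (x ∷ y ∷ z ∷ []) = y ∷ x ∷ z ∷ []
  fromRole third  (x ∷ y ∷ z ∷ []) = y ∷ z ∷ x ∷ []

  byRole-step : ∀ ρ ms s r →
    byRole ρ (guardsStep (fromRole ρ ms) (presidentStep s r)) ≡ guardsStep ms (presidentStep s (byRole ρ r))
  byRole-step first  (_ ∷ _ ∷ _ ∷ []) s (_ ∷ _ ∷ _ ∷ []) = refl
  byRole-step second (_ ∷ _ ∷ _ ∷ []) s (_ ∷ _ ∷ _ ∷ []) = refl
  byRole-step third  (_ ∷ _ ∷ _ ∷ []) s (_ ∷ _ ∷ _ ∷ []) = refl

  occurs-byRole : ∀ {P : Residue → Set} ρ (r : View 3) →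
                  (∃ λ g → P (lookup (byRole ρ r) g)) → ∃ λ g → P (lookup r g)
  occurs-byRole first  (_ ∷ _ ∷ _ ∷ []) occ                    = occ
  occurs-byRole second (_ ∷ _ ∷ _ ∷ []) (fzero , p)            = fsuc fzero , p
  occurs-byRole second (_ ∷ _ ∷ _ ∷ []) (fsuc fzero , p)       = fzero , p
  occurs-byRole second (_ ∷ _ ∷ _ ∷ []) (fsuc (fsuc fzero) , p) = fsuc (fsuc fzero) , p
  occurs-byRole third  (_ ∷ _ ∷ _ ∷ []) (fzero , p)            = fsuc (fsuc fzero) , p
  occurs-byRole third  (_ ∷ _ ∷ _ ∷ []) (fsuc fzero , p)       = fzero , p
  occurs-byRole third  (_ ∷ _ ∷ _ ∷ []) (fsuc (fsuc fzero) , p) = fsuc fzero , p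

  surrounds-byRole : ∀ ρ r → Surrounds (byRole ρ r) → Surrounds r
  surrounds-byRole ρ r (ahead , behind) = occurs-byRole {Ahead} ρ r ahead , occurs-byRole {Behind} ρ r behind

  closeInCostAny : View 3 → ℕ
  closeInCostAny r = closeInCost (byRole first r) ⊓ (closeInCost (byRole second r) ⊓ closeInCost (byRole third r))

  cost₃ : View 3 → ℕ
  cost₃ r = approachCost r ⊓ closeInCostAny r

  cost₃≤approachCost : ∀ r → cost₃ r ≤ approachCost r
  cost₃≤approachCost r = m⊓n≤m _ _

  cost₃≤closeInCost : ∀ ρ r → cost₃ r ≤ closeInCost (byRole ρ r)
  cost₃≤closeInCost first  r = ≤-trans (m⊓n≤n _ _) (m⊓n≤m _ _)
  cost₃≤closeInCost second r = ≤-trans (m⊓n≤n _ _) (≤-trans (m⊓n≤n _ _) (m⊓n≤m _ _))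
  cost₃≤closeInCost third  r = ≤-trans (m⊓n≤n _ _) (≤-trans (m⊓n≤n _ _) (m⊓n≤n _ _))

  cost₃-attained : ∀ r → cost₃ r ≡ approachCost r ⊎ ∃ λ ρ → cost₃ r ≡ closeInCost (byRole ρ r)
  cost₃-attained r with ⊓-sel (approachCost r) (closeInCostAny r)
  ... | inj₁ eq = inj₁ eq
  ... | inj₂ eq with ⊓-sel (closeInCost (byRole first r)) (closeInCost (byRole second r) ⊓ closeInCost (byRole third r))
  ...   | inj₁ eq′ = inj₂ (first , trans eq eq′)
  ...   | inj₂ eq′ with ⊓-sel (closeInCost (byRole second r)) (closeInCost (byRole third r))
  ...     | inj₁ eq″ = inj₂ (second , trans eq (trans eq′ eq″))
  ...     | inj₂ eq″ = inj₂ (third  , trans eq (trans eq′ eq″))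

  cost₃-positive : ∀ r → 1 ≤ cost₃ r
  cost₃-positive r@(a ∷ b ∷ c ∷ []) =
    ⊓-glb (costIf-positive (approachApplies r) (s≤s z≤n))
          (⊓-glb (closeIn-positive first) (⊓-glb (closeIn-positive second) (closeIn-positive third)))
    where
    closeIn-positive : ∀ ρ → 1 ≤ closeInCost (byRole ρ r)
    closeIn-positive first  = costIf-positive _ (s≤s z≤n)
    closeIn-positive second = costIf-positive _ (s≤s z≤n)
    closeIn-positive third  = costIf-positive _ (s≤s z≤n)

  near-after-step : ∀ {x} → T (isNear x) → ∀ t → T (canReachAhead (shift t x)) ⊎ T (canReachBehind (shift t x))
  near-after-step {residue 0 _ _ _}              _ stay = inj₁ _
  near-after-step {residue 0 (suc _) _ _}        _ fwd  = inj₁ _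
  near-after-step {residue 0 _ _ _}              _ bwd  = inj₂ _
  near-after-step {residue 1 _ _ _}              _ stay = inj₁ _
  near-after-step {residue 1 _ refl _}           _ fwd  = inj₁ _
  near-after-step {residue 1 _ _ _}              _ bwd  = inj₁ _
  near-after-step {residue (suc (suc _)) 0 _ _}  _ stay = inj₂ _
  near-after-step {residue (suc (suc _)) 0 _ _}  _ fwd  = inj₁ _
  near-after-step {residue (suc (suc _)) 0 _ _}  _ bwd  = inj₂ _

  apart-after-step : ∀ t u v → T (isApart u) → T (isApart v) →
    up (shift t u) ≡ 0 ⊎ up (shift t v) ≡ 0 ⊎
    (T (isApart (shift t u)) × T (isApart (shift t v)) × up (shift t u) + down (shift t v) ≡ up u + down v)
  apart-after-step stay u v apartU apartV = inj₂ (inj₂ (apartU , apartV , refl))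
  apart-after-step fwd (residue (suc _) 0 _ _)       v                               _ _ = inj₁ refl
  apart-after-step fwd (residue (suc _) (suc _) _ _) (residue (suc _) 0 _ _)         _ _ = inj₂ (inj₁ refl)
  apart-after-step fwd (residue (suc a) (suc _) _ _) (residue (suc _) (suc d) _ _)   _ _ =
    inj₂ (inj₂ (_ , _ , cong suc (sym (+-suc a d))))
  apart-after-step bwd (residue 1 _ _ _)             v                               _ _ = inj₁ refl
  apart-after-step bwd (residue (suc (suc _)) _ _ _) (residue 1 _ _ _)               _ _ = inj₂ (inj₁ refl)
  apart-after-step bwd (residue (suc (suc a)) _ _ _) (residue (suc (suc _)) d _ _)   _ _ =
    inj₂ (inj₂ (_ , _ , cong suc (+-suc a d)))

  pounce : ∀ g u → T (canReachAhead g) ⊎ T (canReachBehind g) → up u ≡ 0 →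
           ∃ λ x → ∃ λ y → (Ahead (shift x g) × Behind (shift y u)) ⊎ (Behind (shift x g) × Ahead (shift y u))
  pounce g (residue 0 _ refl _) (inj₁ reach) refl = let (x , ahead)  = reachAhead g reach  in x , bwd , inj₁ (ahead , refl)
  pounce g (residue 0 _ refl _) (inj₂ reach) refl = let (x , behind) = reachBehind g reach in x , fwd , inj₂ (behind , refl)

  toNear : ∀ g → T (canReachAhead g) ⊎ T (canReachBehind g) → ∃ λ x → T (isNear (shift x g))
  toNear g (inj₁ reach) = let (x , ahead)  = reachAhead g reach  in x , ahead⇒near {shift x g} ahead
  toNear g (inj₂ reach) = let (x , behind) = reachBehind g reach in x , behind⇒near {shift x g} behind

  approach-ahead : ∀ u → T (isApart u) → Ahead u ⊎ (T (isApart (prev u)) × suc (up (prev u)) ≡ up u)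
  approach-ahead (residue 1 _ _ _)             _ = inj₁ refl
  approach-ahead (residue (suc (suc _)) _ _ _) _ = inj₂ (_ , refl)

  approach-behind : ∀ v → T (isApart v) → Behind v ⊎ (T (isApart (next v)) × suc (down (next v)) ≡ down v)
  approach-behind (residue (suc _) 0 _ _)       _ = inj₁ refl
  approach-behind (residue (suc _) (suc _) _ _) _ = inj₂ (_ , refl)

  close-in : ∀ g u v → T (canReachAhead g) ⊎ T (canReachBehind g) → T (isApart u) → T (isApart v) →
             ∃ λ ms → Surrounds (guardsStep ms (g ∷ u ∷ v ∷ []))
                    ⊎ closeInCost (guardsStep ms (g ∷ u ∷ v ∷ [])) ≤ up u + down v
  close-in g u v reach apartU apartV with toNear g reach | approach-ahead u apartU | approach-behind v apartV
  ... | _ , _    | inj₁ ahead           | inj₁ behind =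
    (stay ∷ stay ∷ stay ∷ []) , inj₁ ((fsuc fzero , ahead) , (fsuc (fsuc fzero) , behind))
  ... | x , near | inj₁ ahead           | inj₂ (apartV′ , dv) = (x ∷ stay ∷ fwd ∷ []) , inj₂ (≤-reflexive (begin
    closeInCost (shift x g ∷ u ∷ next v ∷ [])  ≡⟨ costIf-applies _ (all³ near apartU apartV′) ⟩
    suc (up u + down (next v))                 ≡⟨ +-suc (up u) _ ⟨
    up u + suc (down (next v))                 ≡⟨ cong (up u +_) dv ⟩
    up u + down v                              ∎))
    where open ≡-Reasoning
  ... | x , near | inj₂ (apartU′ , du) | inj₁ behind = (x ∷ bwd ∷ stay ∷ []) , inj₂ (≤-reflexive
    (trans (costIf-applies _ (all³ near apartU′ apartV)) (cong (_+ down v) du)))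
  ... | x , near | inj₂ (apartU′ , du) | inj₂ (apartV′ , dv) = (x ∷ bwd ∷ fwd ∷ []) , inj₂ (begin
    closeInCost (shift x g ∷ prev u ∷ next v ∷ [])  ≡⟨ costIf-applies _ (all³ near apartU′ apartV′) ⟩
    suc (up (prev u)) + down (next v)               ≡⟨ cong (_+ down (next v)) du ⟩
    up u + down (next v)                            ≤⟨ +-monoʳ-≤ (up u) (≤-trans (n≤1+n _) (≤-reflexive dv)) ⟩
    up u + down v                                   ∎)
    where open ≤-Reasoning

  closeIn-step : ∀ q s → T (closeInApplies q) → ∃ λ ms →
    Surrounds (guardsStep ms (presidentStep s q)) ⊎ closeInCost (guardsStep ms (presidentStep s q)) < closeInCost q
  closeIn-step q@(g ∷ u ∷ v ∷ []) s applies
    with split³ {isNear g} {isApart u} {isApart v} applies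
  ... | near , apartU , apartV with apart-after-step (reverse s) u v apartU apartV
  ...   | inj₁ u₀ with pounce (shift (reverse s) g) (shift (reverse s) u) (near-after-step near (reverse s)) u₀
  ...     | x , y , inj₁ (ahead , behind) = (x ∷ y ∷ stay ∷ []) , inj₁ ((fzero , ahead) , (fsuc fzero , behind))
  ...     | x , y , inj₂ (behind , ahead) = (x ∷ y ∷ stay ∷ []) , inj₁ ((fsuc fzero , ahead) , (fzero , behind))
  closeIn-step q@(g ∷ u ∷ v ∷ []) s applies | near , apartU , apartV | inj₂ (inj₁ v₀)
    with pounce (shift (reverse s) g) (shift (reverse s) v) (near-after-step near (reverse s)) v₀
  ...     | x , y , inj₁ (ahead , behind) = (x ∷ stay ∷ y ∷ []) , inj₁ ((fzero , ahead) , (fsuc (fsuc fzero) , behind))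
  ...     | x , y , inj₂ (behind , ahead) = (x ∷ stay ∷ y ∷ []) , inj₁ ((fsuc (fsuc fzero) , ahead) , (fzero , behind))
  closeIn-step q@(g ∷ u ∷ v ∷ []) s applies | near , apartU , apartV | inj₂ (inj₂ (apartU′ , apartV′ , same))
    with close-in _ _ _ (near-after-step near (reverse s)) apartU′ apartV′
  ...     | ms , inj₁ surrounds = ms , inj₁ surrounds
  ...     | ms , inj₂ le = ms , inj₂ (subst (closeInCost (guardsStep ms (presidentStep s q)) <_)
                                           (sym (costIf-applies _ applies)) (s≤s (≤-trans le (≤-reflexive same))))

  closeIn-step-byRole : ∀ ρ r s → T (closeInApplies (byRole ρ r)) → ∃ λ ms →
    Surrounds (guardsStep ms (presidentStep s r)) ⊎ cost₃ (guardsStep ms (presidentStep s r)) < closeInCost (byRole ρ r)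
  closeIn-step-byRole ρ r s applies with closeIn-step (byRole ρ r) s applies
  ... | ms , outcome = fromRole ρ ms , Sum.map (surrounds-byRole ρ _ ∘ subst Surrounds (sym same))
                                          (≤-<-trans (≤-trans (cost₃≤closeInCost ρ _)
                                                              (≤-reflexive (cong closeInCost same))))
                                          outcome
    where
    same : byRole ρ (guardsStep (fromRole ρ ms) (presidentStep s r)) ≡ guardsStep ms (presidentStep s (byRole ρ r))
    same = byRole-step ρ ms s r

  far⇒apart-after : ∀ x → T (isFar x) → ∀ t → T (isApart (shift t x))
  far⇒apart-after (residue (suc (suc _)) (suc _) _ _) _ stay = _
  far⇒apart-after (residue (suc (suc _)) (suc _) _ _) _ fwd  = _
  far⇒apart-after (residue (suc (suc _)) (suc _) _ _) _ bwd  = _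

  far-shift-sum : ∀ {a b} → T (isFar a) → T (isFar b) → ∀ t → up (shift t a) + down (shift t b) ≡ up a + down b
  far-shift-sum {residue (suc (suc _)) (suc _) _ _} {residue (suc (suc _)) (suc _) _ _} _ _ stay = refl
  far-shift-sum {residue (suc (suc a)) (suc _) _ _} {residue (suc (suc _)) (suc d) _ _} _ _ fwd  =
    cong (suc ∘ suc) (sym (+-suc a d))
  far-shift-sum {residue (suc (suc a)) (suc _) _ _} {residue (suc (suc _)) (suc d) _ _} _ _ bwd  =
    cong suc (+-suc a (suc d))

  far-close-sum : ∀ {a b} → T (isFar a) → T (isFar b) → suc (suc (up (prev a) + down (next b))) ≡ up a + down b
  far-close-sum {residue (suc (suc a)) (suc _) _ _} {residue (suc (suc _)) (suc d) _ _} _ _ =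
    cong (suc ∘ suc) (sym (+-suc a d))

  approachBase<bound : approachBase < bound
  approachBase<bound = m<m+n approachBase (s≤s z≤n)

  switch : ∀ ρ q → T (closeInApplies (byRole ρ q)) → cost₃ q < approachBase
  switch ρ q applies = ≤-<-trans (cost₃≤closeInCost ρ q) (closeInCost<approachBase (byRole ρ q) applies)

  switched : ∀ {W} q ρ → T (closeInApplies (byRole ρ q)) → cost₃ q < approachBase + W
  switched {W} q ρ applies = <-≤-trans (switch ρ q applies) (m≤m+n approachBase W)

  stays squeeze : Vec Step 3
  stays   = stay ∷ stay ∷ stay ∷ []
  squeeze = bwd ∷ fwd ∷ stay ∷ []

  approach-move : ∀ a b c → T (isApart a) → T (isApart b) → T (isApart c) →
                  ∃ λ ms → cost₃ (guardsStep ms (a ∷ b ∷ c ∷ [])) < approachBase + (up a + down b)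
  approach-move a b c apartA apartB apartC
    with near-or-far a | near-or-far b | near-or-far c
  ... | inj₁ nearA | _          | _          = stays , switched (a ∷ b ∷ c ∷ []) first  (all³ nearA apartB apartC)
  ... | inj₂ _     | inj₁ nearB | _          = stays , switched (a ∷ b ∷ c ∷ []) second (all³ nearB apartA apartC)
  ... | inj₂ _     | inj₂ _     | inj₁ nearC = stays , switched (a ∷ b ∷ c ∷ []) third  (all³ nearC apartA apartB)
  ... | inj₂ farA  | inj₂ farB  | inj₂ farC
    with near-or-far (prev a) | near-or-far (next b)
  ...   | inj₁ nearA′ | _           = squeeze , switched (prev a ∷ next b ∷ c ∷ []) first
                                        (all³ nearA′ (far⇒apart-after b farB fwd) (far⇒apart-after c farC stay))
  ...   | inj₂ _      | inj₁ nearB′ = squeeze , switched (prev a ∷ next b ∷ c ∷ []) second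
                                        (all³ nearB′ (far⇒apart-after a farA bwd) (far⇒apart-after c farC stay))
  ...   | inj₂ farA′  | inj₂ farB′  = squeeze , (begin-strict
    cost₃ (prev a ∷ next b ∷ c ∷ [])                       ≤⟨ cost₃≤approachCost (prev a ∷ next b ∷ c ∷ []) ⟩
    approachCost (prev a ∷ next b ∷ c ∷ [])                ≡⟨ costIf-applies _ (all³ farA′ farB′ farC) ⟩
    approachBase + (up (prev a) + down (next b))           <⟨ +-monoʳ-< approachBase (s≤s (n≤1+n _)) ⟩
    approachBase + suc (suc (up (prev a) + down (next b))) ≡⟨ cong (approachBase +_) (far-close-sum {a} {b} farA farB) ⟩
    approachBase + (up a + down b)                         ∎)
    where open ≤-Reasoning

  approach-step : ∀ r s → T (approachApplies r) → ∃ λ ms → cost₃ (guardsStep ms (presidentStep s r)) < approachCost r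
  approach-step r@(a ∷ b ∷ c ∷ []) s applies =
    let (farA , farB , farC) = split³ {isFar a} {isFar b} {isFar c} applies
        t = reverse s
        (ms , lt) = approach-move (shift t a) (shift t b) (shift t c)
                      (far⇒apart-after a farA t) (far⇒apart-after b farB t) (far⇒apart-after c farC t)
    in ms , subst (cost₃ (guardsStep ms (presidentStep s r)) <_)
                  (trans (cong (approachBase +_) (far-shift-sum {a} {b} farA farB t)) (sym (costIf-applies _ applies)))
                  lt

  approachCost<bound⇒applies : ∀ r → approachCost r < bound → T (approachApplies r)
  approachCost<bound⇒applies r@(_ ∷ _ ∷ _ ∷ []) = costIf<bound⇒applies (approachApplies r)

  closeInCost<bound⇒applies : ∀ q → closeInCost q < bound → T (closeInApplies q)
  closeInCost<bound⇒applies q@(_ ∷ _ ∷ _ ∷ []) = costIf<bound⇒applies (closeInApplies q)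

  opening : ∀ x → ∃ λ ms → cost₃ (guardsStep ms (replicate 3 x)) < bound
  opening x@(residue 0 _ refl _) =
    (stay ∷ fwd ∷ bwd ∷ []) , <-trans (switch first (x ∷ next x ∷ prev x ∷ []) _) approachBase<bound
  opening x@(residue (suc _) _ _ _) with near-or-far x
  ... | inj₁ near = stays , <-trans (switch first (x ∷ x ∷ x ∷ []) (all³ {isNear x} {isApart x} {isApart x} near _ _))
                                   approachBase<bound
  ... | inj₂ far  = stays , ≤-<-trans (cost₃≤approachCost (x ∷ x ∷ x ∷ []))
                                     (approachCost<bound (x ∷ x ∷ x ∷ []) (all³ {isFar x} {isFar x} {isFar x} far far far))

  progress : ∀ r s → cost₃ r < bound → ∃ λ ms →
    Surrounds (guardsStep ms (presidentStep s r)) ⊎ cost₃ (guardsStep ms (presidentStep s r)) < cost₃ r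
  progress r s lt with cost₃-attained r
  ... | inj₁ eq = map₂ (λ {ms} lt′ → inj₂ (subst (cost₃ (guardsStep ms (presidentStep s r)) <_) (sym eq) lt′))
                       (approach-step r s (approachCost<bound⇒applies r (subst (_< bound) eq lt)))
  ... | inj₂ (ρ , eq) = map₂ (λ {ms} → Sum.map₂ (subst (cost₃ (guardsStep ms (presidentStep s r)) <_) (sym eq)))
                             (closeIn-step-byRole ρ r s (closeInCost<bound⇒applies (byRole ρ r) (subst (_< bound) eq lt)))

  wins : BGWins
  wins = ByCost.wins cost₃ bound cost₃-positive opening progress

trapReachable-small : ∀ m → m ≤ 2 → (r : Residues.View (2 + m) 2) → Residues.TrapReachable (2 + m) r
trapReachable-small 0 _ = from-yes (Residues.∀-view? 2 {2} (Residues.trapReachable? 2))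
trapReachable-small 1 _ = from-yes (Residues.∀-view? 3 {2} (Residues.trapReachable? 3))
trapReachable-small 2 _ = from-yes (Residues.∀-view? 4 {2} (Residues.trapReachable? 4))
trapReachable-small (suc (suc (suc _))) (s≤s (s≤s ()))

bodyguardNumber-small : ∀ m (h : 3 ≤ 3 + m) → m ≤ 2 → BodyguardNumberIs (Cycle (3 + m) h) 2
bodyguardNumber-small m h m≤2 =
  CycleGame.trapReachable⇒wins m h 2 (trapReachable-small m m≤2) , CycleGame.fewer-than-two-lose m h

bodyguardNumber-large : ∀ m (h : 3 ≤ 3 + m) → 3 ≤ m → BodyguardNumberIs (Cycle (3 + m) h) 3
bodyguardNumber-large (suc (suc (suc m))) h _ = ThreeGuardsWin.wins m h , fewer-than-three-lose
  where
  fewer-than-three-lose : ∀ k → k < 3 → ¬ BodyguardsWin (Cycle (6 + m) h) k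
  fewer-than-three-lose k k<3 with m<1+n⇒m<n∨m≡n k<3
  ... | inj₁ k<2  = CycleGame.fewer-than-two-lose (3 + m) h k k<2
  ... | inj₂ refl = TwoGuardsLose.loses m h
bodyguardNumber-large 1 h (s≤s ())
bodyguardNumber-large 2 h (s≤s (s≤s ()))

theorem3p1 : (n : ℕ) (h : 3 ≤ n) →
    (n ≤ 5 → BodyguardNumberIs (Cycle n h) 2) × (5 < n → BodyguardNumberIs (Cycle n h) 3)
theorem3p1 (suc zero)          (s≤s ())
theorem3p1 (suc (suc zero))    (s≤s (s≤s ()))
theorem3p1 (suc (suc (suc m))) h =
  (λ n≤5 → bodyguardNumber-small m h (≤-pred (≤-pred (≤-pred n≤5)))) ,
  (λ 5<n → bodyguardNumber-large m h (≤-pred (≤-pred (≤-pred 5<n))))
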